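{- Let $M$ be a (partially) ordered set and $L$ a linearly ordered lattice. Let $\varphi: M\to\mathcal{I}_L$ be a map (regarded as a correspondence from $M$ to $L$ with nonempty values). Then $\varphi$ is increasing if and only if for all $x_1,x_2\in M$, $x_1\le x_2$ implies $\varphi(x_1)\sqsubseteq\varphi(x_2)$.
   Context: A correspondence $\varphi$ from a set $M$ to a set $L$ is a map $M\to 2^L$; its graph is $\mathrm{graph}(\varphi)=\{(x,y)\in M\times L: y\in\varphi(x)\}$. For ordered $M$, $L$, a correspondence $\varphi$ is called increasing if for all $(x_1,y_2),(x_2,y_1)\in\mathrm{graph}(\varphi)$ with $x_1\le x_2$ and $y_1\le y_2$, the whole rectangle $[x_1,x_2]\times[y_1,y_2]$ is contained in $\mathrm{graph}(\varphi)$, where $[a,b]=\{z: a\le z\le b\}$. A subset $I\subseteq L$ is a (preference) interval if for all $a,b\in I$ the closed interval $[a,b]$ is contained in $I$; $\mathcal{I}_L$ denotes the set of all nonempty preference intervals of $L$. For nonempty $Y_1,Y_2\subseteq L$ (Topkis' relation) $Y_1\sqsubseteq Y_2$ means: $y_1\wedge y_2\in Y_1$ and $y_1\vee y_2\in Y_2$ for all $y_1\in Y_1$, $y_2\in Y_2$. -}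

module Defs where

open import Level using (Level; _⊔_; suc)
open import Data.Product using (_×_; Σ; ∃)
open import Relation.Unary using (Pred; _∈_)
open import Relation.Binary.Core using (Rel)
open import Relation.Binary.Definitions using (Total)
open import Relation.Binary.Bundles using (Poset)
open import Relation.Binary.Lattice.Bundles using (Lattice)

module _ {a ℓ : Level} {A : Set a} (_≤_ : Rel A ℓ) where
  closedInterval : A → A → Pred A ℓ
  closedInterval x y z = (x ≤ z) × (z ≤ y)

record LinearLattice (c ℓ₁ ℓ₂ : Level) : Set (suc (c ⊔ ℓ₁ ⊔ ℓ₂)) where
  field
    lattice : Lattice c ℓ₁ ℓ₂
  open Lattice lattice public
  field
    total : Total _≤_

module _ {c ℓ₁ ℓ₂ ℓ : Level} (L : LinearLattice c ℓ₁ ℓ₂) where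
  open LinearLattice L

  -- Subsets of L are predicates; being a genuine subset means
  -- closure under the carrier's equality _≈_.
  Respects≈ : Pred Carrier ℓ → Set (c ⊔ ℓ₁ ⊔ ℓ)
  Respects≈ Y = ∀ {y z} → y ≈ z → y ∈ Y → z ∈ Y

  Nonempty : Pred Carrier ℓ → Set (c ⊔ ℓ)
  Nonempty Y = ∃ λ y → y ∈ Y

  IsInterval : Pred Carrier ℓ → Set (c ⊔ ℓ₂ ⊔ ℓ)
  IsInterval I = ∀ {a b} → a ∈ I → b ∈ I → ∀ {z} → z ∈ closedInterval _≤_ a b → z ∈ I

  Is𝓘 : Pred Carrier ℓ → Set (c ⊔ ℓ₁ ⊔ ℓ₂ ⊔ ℓ)
  Is𝓘 I = Respects≈ I × Nonempty I × IsInterval I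

  _⊑_ : Pred Carrier ℓ → Pred Carrier ℓ → Set (c ⊔ ℓ)
  Y₁ ⊑ Y₂ = ∀ {y₁ y₂} → y₁ ∈ Y₁ → y₂ ∈ Y₂ → ((y₁ ∧ y₂) ∈ Y₁) × ((y₁ ∨ y₂) ∈ Y₂)

module _ {c₁ ℓ₁₁ ℓ₁₂ c ℓ₁ ℓ₂ ℓ : Level}
         (M : Poset c₁ ℓ₁₁ ℓ₁₂) (L : LinearLattice c ℓ₁ ℓ₂) where
  private
    module M = Poset M
    module L = LinearLattice L

  Correspondence : Set (c₁ ⊔ c ⊔ suc ℓ)
  Correspondence = M.Carrier → Pred L.Carrier ℓ

  graph : Correspondence → M.Carrier → L.Carrier → Set ℓ
  graph φ x y = y ∈ φ x

  Increasing : Correspondence → Set (c₁ ⊔ c ⊔ ℓ₁₂ ⊔ ℓ₂ ⊔ ℓ)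
  Increasing φ = ∀ {x₁ x₂ y₁ y₂} → graph φ x₁ y₂ → graph φ x₂ y₁ →
    x₁ M.≤ x₂ → y₁ L.≤ y₂ →
    ∀ {x y} → x ∈ closedInterval M._≤_ x₁ x₂ → y ∈ closedInterval L._≤_ y₁ y₂ → graph φ x y

module Submission where

-- The two directions rest on different facts.
-- (⇒) Increasingness, applied to the degenerate rectangles spanned by
--     (x₁,y₁) ∈ graph φ and (x₂,y₂) ∈ graph φ with y₂ ≤ y₁, says exactly
--     that such "inverted" values may be swapped: y₂ ∈ φ x₁ and y₁ ∈ φ x₂.
--     In a chain the meet and join of two elements are the elements
--     themselves, so swap-closure of two ≈-closed sets is Topkis' relation.
-- (⇐) No linearity is needed: given a rectangle and a point (x,y) in it,
--     pick any z ∈ φ x; monotonicity of φ w.r.t. ⊑ puts z ∧ y₁ and y₂ ∨ z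
--     in φ x, and these bracket y, so y ∈ φ x because φ x is an interval.

open import Defs
open import Level using (Level)
open import Function.Bundles using (_⇔_; mk⇔)
open import Relation.Binary.Bundles using (Poset)
open import Relation.Unary using (Pred; _∈_)
open import Data.Product using (_×_; _,_)
open import Data.Sum using (inj₁; inj₂)
import Relation.Binary.Lattice.Properties.JoinSemilattice as JoinProperties
import Relation.Binary.Lattice.Properties.MeetSemilattice as MeetProperties

module Topkis {c ℓ₁ ℓ₂ : Level} (L : LinearLattice c ℓ₁ ℓ₂) where
  open LinearLattice L
  open JoinProperties joinSemilattice using (x≤y⇒x∨y≈y; ∨-comm)
  open MeetProperties meetSemilattice using (y≤x⇒x∧y≈y; ∧-comm)

  meet-join-of-≤ : ∀ {a b} → a ≤ b → (a ∧ b ≈ a) × (a ∨ b ≈ b)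
  meet-join-of-≤ {a} {b} a≤b =
    Eq.trans (∧-comm a b) (y≤x⇒x∧y≈y a≤b) , x≤y⇒x∨y≈y a≤b

  meet-join-of-≥ : ∀ {a b} → b ≤ a → (a ∧ b ≈ b) × (a ∨ b ≈ a)
  meet-join-of-≥ {a} {b} b≤a =
    y≤x⇒x∧y≈y b≤a , Eq.trans (∨-comm a b) (x≤y⇒x∨y≈y b≤a)

  SwapClosed : ∀ {ℓ} → Pred Carrier ℓ → Pred Carrier ℓ → Set _
  SwapClosed Y₁ Y₂ = ∀ {y₁ y₂} → y₁ ∈ Y₁ → y₂ ∈ Y₂ → y₂ ≤ y₁ → (y₂ ∈ Y₁) × (y₁ ∈ Y₂)

  swapClosed⇒⊑ : ∀ {ℓ} {Y₁ Y₂ : Pred Carrier ℓ} →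
    Respects≈ L Y₁ → Respects≈ L Y₂ → SwapClosed Y₁ Y₂ → _⊑_ L Y₁ Y₂
  swapClosed⇒⊑ resp₁ resp₂ swap {y₁} {y₂} y₁∈Y₁ y₂∈Y₂ with total y₁ y₂
  ... | inj₁ y₁≤y₂ =
    let meet≈ , join≈ = meet-join-of-≤ y₁≤y₂
    in resp₁ (Eq.sym meet≈) y₁∈Y₁ , resp₂ (Eq.sym join≈) y₂∈Y₂
  ... | inj₂ y₂≤y₁ =
    let meet≈ , join≈ = meet-join-of-≥ y₂≤y₁
        y₂∈Y₁ , y₁∈Y₂ = swap y₁∈Y₁ y₂∈Y₂ y₂≤y₁
    in resp₁ (Eq.sym meet≈) y₂∈Y₁ , resp₂ (Eq.sym join≈) y₁∈Y₂

module IncreasingCorrespondence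
    {c₁ ℓ₁₁ ℓ₁₂ c ℓ₁ ℓ₂ ℓ : Level}
    (M : Poset c₁ ℓ₁₁ ℓ₁₂) (L : LinearLattice c ℓ₁ ℓ₂)
    (φ : Correspondence {ℓ = ℓ} M L) where
  private module M = Poset M
  open LinearLattice L
  open Topkis L using (SwapClosed)

  -- An increasing correspondence lets inverted values at x₁ ≤ x₂ be
  -- swapped: these are two corners of the rectangle [x₁,x₂] × [y₂,y₁].
  increasing⇒swapClosed : Increasing M L φ →
    ∀ {x₁ x₂} → x₁ M.≤ x₂ → SwapClosed (φ x₁) (φ x₂)
  increasing⇒swapClosed inc x₁≤x₂ y₁∈φx₁ y₂∈φx₂ y₂≤y₁ =
    inc y₁∈φx₁ y₂∈φx₂ x₁≤x₂ y₂≤y₁ (M.refl , x₁≤x₂) (refl , y₂≤y₁) ,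
    inc y₁∈φx₁ y₂∈φx₂ x₁≤x₂ y₂≤y₁ (x₁≤x₂ , M.refl) (y₂≤y₁ , refl)

  ⊑-monotone⇒increasing :
    (∀ x → Nonempty L (φ x)) → (∀ x → IsInterval L (φ x)) →
    (∀ {x₁ x₂} → x₁ M.≤ x₂ → _⊑_ L (φ x₁) (φ x₂)) → Increasing M L φ
  ⊑-monotone⇒increasing nonempty interval monotone
    {y₁ = y₁} {y₂} y₂∈φx₁ y₁∈φx₂ _ _ {x} (x₁≤x , x≤x₂) (y₁≤y , y≤y₂)
    with nonempty x
  ... | z , z∈φx =
    let z∧y₁∈φx , _ = monotone x≤x₂ z∈φx y₁∈φx₂
        _ , y₂∨z∈φx = monotone x₁≤x y₂∈φx₁ z∈φx
    in interval x z∧y₁∈φx y₂∨z∈φx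
         (trans (x∧y≤y z y₁) y₁≤y , trans y≤y₂ (x≤x∨y y₂ z))

proposition3p1 : ∀ {c₁ ℓ₁₁ ℓ₁₂ c ℓ₁ ℓ₂ ℓ : Level}
    (M : Poset c₁ ℓ₁₁ ℓ₁₂) (L : LinearLattice c ℓ₁ ℓ₂)
    (φ : Correspondence {ℓ = ℓ} M L) →
    (∀ x → Is𝓘 L (φ x)) →
    Increasing M L φ ⇔
    (∀ {x₁ x₂} → Poset._≤_ M x₁ x₂ → _⊑_ L (φ x₁) (φ x₂))
proposition3p1 M L φ is𝓘 = mk⇔ monotone increasing
  where
  open IncreasingCorrespondence M L φ
  open Topkis L using (swapClosed⇒⊑)

  respects : ∀ x → Respects≈ L (φ x)
  respects x = let resp , _ , _ = is𝓘 x in resp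

  monotone : Increasing M L φ →
    ∀ {x₁ x₂} → Poset._≤_ M x₁ x₂ → _⊑_ L (φ x₁) (φ x₂)
  monotone inc {x₁} {x₂} x₁≤x₂ =
    swapClosed⇒⊑ (respects x₁) (respects x₂) (increasing⇒swapClosed inc x₁≤x₂)

  increasing : (∀ {x₁ x₂} → Poset._≤_ M x₁ x₂ → _⊑_ L (φ x₁) (φ x₂)) →
    Increasing M L φ
  increasing = ⊑-monotone⇒increasing
    (λ x → let _ , nonempty , _ = is𝓘 x in nonempty)
    (λ x → let _ , _ , interval = is𝓘 x in interval)
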